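{- For any prime power $q > 2$, there is no linear $(2,q+1,q)$-AONT; that is, there is no invertible $(q+1)\times(q+1)$ matrix over $\mathbb{F}_q$ all of whose $2\times 2$ submatrices are invertible.
   Context: For a prime power $q$ and integers $1 \le t \le s$, a linear $(t,s,q)$-all-or-nothing transform (AONT) is an invertible $s\times s$ matrix $M$ over $\mathbb{F}_q$ defining the bijection $\mathbf{y}\mapsto \mathbf{x}=\mathbf{y}M$ of $\mathbb{F}_q^s$ such that, for every set $I$ of $t$ input coordinates and every set $J$ of $t$ output coordinates, knowing the $s-t$ output values $y_j$, $j\notin J$, gives no information about the values $x_i$, $i \in I$. It is a known fact that an invertible $M$ is a linear $(t,s,q)$-AONT if and only if every $t\times t$ submatrix of $M$ is invertible. -}

module Defs where

open import Level using (Level; _⊔_)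
import Data.Fin
open import Algebra.Bundles using (CommutativeRing)
open import Data.Nat as ℕ using (ℕ; zero; suc; _^_)
open import Data.Nat.Primality using (Prime)
open import Data.Fin using (Fin; zero; suc)
open import Data.Product using (Σ; ∃; _×_; _,_)
open import Relation.Binary.PropositionalEquality using (_≡_)
open import Relation.Nullary using (¬_)

IsPrimePower : ℕ → Set
IsPrimePower q = Σ ℕ λ p → Σ ℕ λ k → Prime p × (q ≡ p ^ suc k)

record Field (c ℓ : Level) : Set (Level.suc (c ⊔ ℓ)) where
  field
    commutativeRing : CommutativeRing c ℓ
  open CommutativeRing commutativeRing public
  field
    0≉1     : ¬ (0# ≈ 1#)
    inverse : ∀ x → ¬ (x ≈ 0#) → Σ Carrier λ y → (x * y) ≈ 1#

HasOrder : ∀ {c ℓ} → Field c ℓ → ℕ → Set (c ⊔ ℓ)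
HasOrder F q = Σ (Fin q → Carrier) λ e →
                 (∀ i j → e i ≈ e j → i ≡ j) × (∀ x → Σ (Fin q) λ i → e i ≈ x)
  where open Field F

module Matrices {c ℓ} (F : Field c ℓ) where
  open Field F using (Carrier; _≈_; 0#; 1#; _+_; _*_)

  Matrix : ℕ → Set c
  Matrix n = Fin n → Fin n → Carrier

  ∑ : ∀ {n} → (Fin n → Carrier) → Carrier
  ∑ {zero}  f = 0#
  ∑ {suc n} f = f zero + ∑ (λ i → f (suc i))

  _⊗_ : ∀ {n} → Matrix n → Matrix n → Matrix n
  (A ⊗ B) i j = ∑ λ k → A i k * B k j

  I : ∀ {n} → Matrix n
  I i j with i Data.Fin.≟ j
  ... | Relation.Nullary.yes _ = 1#
  ... | Relation.Nullary.no  _ = 0#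

  _≋_ : ∀ {n} → Matrix n → Matrix n → Set ℓ
  A ≋ B = ∀ i j → A i j ≈ B i j

  Invertible : ∀ {n} → Matrix n → Set (c ⊔ ℓ)
  Invertible {n} A = Σ (Matrix n) λ B → (A ⊗ B) ≋ I × (B ⊗ A) ≋ I

  sub2 : ∀ {s} → Matrix s → Fin s → Fin s → Fin s → Fin s → Matrix 2
  sub2 M i j k l a b = M (pick i j a) (pick k l b)
    where
      pick : ∀ {s} → Fin s → Fin s → Fin 2 → Fin s
      pick x y zero = x
      pick x y (suc _) = y

  All2x2Invertible : ∀ {s} → Matrix s → Set (c ⊔ ℓ)
  All2x2Invertible M = ∀ i j k l → i Data.Fin.< j → k Data.Fin.< l →
                         Invertible (sub2 M i j k l)

  -- linear (2,s,q)-AONT over F (by the characterisation in the paper)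
  IsLinear2AONT : ∀ {s} → Matrix s → Set (c ⊔ ℓ)
  IsLinear2AONT M = Invertible M × All2x2Invertible M

-- Let r be the first column of M. No 2×2 minor vanishes, so for each further column c the
-- rows i are sent injectively, hence bijectively, to the q + 1 points [r i ∶ M i c] of the
-- projective line over F. With v i = recip (r i), i.e. 1 / r i or 0 if r i = 0, the c-th entry of
-- v M is therefore the sum of all elements of F, which vanishes as q > 2, and the 0-th entry
-- is q · 1 = 0. So v is a nonzero left kernel vector of M, and M has no right inverse.
module Submission where

open import Defs
open import Data.Nat using (ℕ; suc; _<_)
open import Data.Product using (Σ)
open import Relation.Nullary using (¬_)

open import Data.Nat using (zero; z<s; s≤s)
import Data.Nat.Properties as ℕₚ
open import Data.Fin as Fin using (Fin; zero; suc; punchOut)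
import Data.Fin.Properties as Finₚ
open import Data.Fin.Patterns using (0F; 1F; 2F)
open import Data.Fin.Permutation using (Permutation; permutation)
open import Data.Product using (_,_; proj₁; proj₂; ∃; _×_; map₂; swap)
open import Function.Base using (_∘_)
open import Function.Definitions using (Injective; StrictlySurjective)
open import Relation.Binary.Definitions using (Decidable; tri<; tri≈; tri>)
open import Relation.Binary.PropositionalEquality using (_≡_; _≢_; refl; cong)
import Relation.Binary.PropositionalEquality as ≡
open import Relation.Nullary using (yes; no; contradiction)

injective⇒strictlySurjective : ∀ {n} {f : Fin n → Fin n} →
                               Injective _≡_ _≡_ f → StrictlySurjective _≡_ f
injective⇒strictlySurjective {suc m} {f} f-inj j with Finₚ.any? (λ i → f i Finₚ.≟ j)
... | yes hit = hit
... | no miss = contradiction (Finₚ.injective⇒≤ g-inj) ℕₚ.1+n≰n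
  where
  f≢j : ∀ i → j ≢ f i
  f≢j i j≡fi = miss (i , ≡.sym j≡fi)

  g : Fin (suc m) → Fin m
  g i = punchOut (f≢j i)

  g-inj : Injective _≡_ _≡_ g
  g-inj = f-inj ∘ Finₚ.punchOut-injective (f≢j _) (f≢j _)

injective⇒permutation : ∀ {n} {f : Fin n → Fin n} → Injective _≡_ _≡_ f → Permutation n n
injective⇒permutation {f = f} f-inj =
  permutation f (proj₁ ∘ onto) (proj₂ ∘ onto) (λ i → f-inj (proj₂ (onto (f i))))
  where
  onto : StrictlySurjective _≡_ f
  onto = injective⇒strictlySurjective f-inj

module _ {a ℓ} (F : Field a ℓ) where
  open Field F renaming (zero to *-zero; refl to ≈-refl)
  open Matrices F
  open import Algebra.Properties.Ring ring
    using (-‿distribˡ-*; -‿injective; -0#≈0#; +-identityʳ-unique; +-cancelʳ;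
           x∙y⁻¹≈ε⇒x≈y; x≈y⇒x∙y⁻¹≈ε; [y-z]x≈yx-zx)
  open import Algebra.Properties.Semiring.Sum semiring
    using (sum; sum-cong-≋; ∑-distrib-+; ∑-comm; ∑-permute; *-distribˡ-sum; *-distribʳ-sum;
           sum-replicate-zero)
  open import Relation.Binary.Reasoning.Setoid setoid

  ∑≡sum : ∀ {n} (f : Fin n → Carrier) → ∑ f ≡ sum f
  ∑≡sum {zero} f = refl
  ∑≡sum {suc n}  f = cong (f zero +_) (∑≡sum (f ∘ suc))

  sum-reindex : ∀ {n} {h : Fin n → Fin n} → Injective _≡_ _≡_ h →
                (w : Fin n → Carrier) → sum (w ∘ h) ≈ sum w
  sum-reindex h-inj w = sym (∑-permute w (injective⇒permutation h-inj))

  sum-single : ∀ {n} {f : Fin n → Carrier} j → (∀ i → i ≢ j → f i ≈ 0#) → sum f ≈ f j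
  sum-single {suc n} zero f≈0 =
    trans (+-congˡ (trans (sum-cong-≋ (λ i → f≈0 (suc i) λ ())) (sum-replicate-zero n)))
          (+-identityʳ _)
  sum-single {suc n} (suc j) f≈0 =
    trans (+-cong (f≈0 zero λ ()) (sum-single j (λ i i≢j → f≈0 (suc i) (i≢j ∘ Finₚ.suc-injective))))
          (+-identityˡ _)

  I-diag : ∀ {n} (i : Fin n) → I i i ≈ 1#
  I-diag i with i Finₚ.≟ i
  ... | yes _   = ≈-refl
  ... | no i≢i = contradiction refl i≢i

  I-off : ∀ {n} {i j : Fin n} → i ≢ j → I i j ≈ 0#
  I-off {i = i} {j} i≢j with i Finₚ.≟ j
  ... | yes i≡j = contradiction i≡j i≢j
  ... | no _    = ≈-refl

  rightInvertible⇒leftKernel≈0 : ∀ {n} {A B : Matrix n} → (A ⊗ B) ≋ I →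
                                 (u : Fin n → Carrier) → (∀ k → sum (λ i → u i * A i k) ≈ 0#) →
                                 ∀ j → u j ≈ 0#
  rightInvertible⇒leftKernel≈0 {n} {A} {B} AB≋I u uA≈0 j = begin
    u j                                          ≈⟨ trans (*-congˡ (I-diag j)) (*-identityʳ _) ⟨
    u j * I j j                                  ≈⟨ sum-single j (λ i i≢j → trans (*-congˡ (I-off i≢j)) (zeroʳ _)) ⟨
    sum (λ i → u i * I i j)                      ≈⟨ sum-cong-≋ (λ i → *-congˡ (trans (sym (AB≋I i j)) (reflexive (∑≡sum (λ k → A i k * B k j))))) ⟩
    sum (λ i → u i * sum (λ k → A i k * B k j))  ≈⟨ sum-cong-≋ (λ i → *-distribˡ-sum (u i) (λ k → A i k * B k j)) ⟩
    sum (λ i → sum (λ k → u i * (A i k * B k j))) ≈⟨ ∑-comm (λ i k → u i * (A i k * B k j)) ⟩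
    sum (λ k → sum (λ i → u i * (A i k * B k j))) ≈⟨ sum-cong-≋ (λ k → sum-cong-≋ (λ i → *-assoc (u i) (A i k) (B k j))) ⟨
    sum (λ k → sum (λ i → u i * A i k * B k j))  ≈⟨ sum-cong-≋ (λ k → *-distribʳ-sum (B k j) (λ i → u i * A i k)) ⟨
    sum (λ k → sum (λ i → u i * A i k) * B k j)  ≈⟨ sum-cong-≋ (λ k → trans (*-congʳ (uA≈0 k)) (zeroˡ (B k j))) ⟩
    sum {n} (λ k → 0#)                           ≈⟨ sum-replicate-zero n ⟩
    0#                                           ∎

  -- If ad ≈ bc then (c, -a) and (d, -b) annihilate A, so a ≈ b ≈ 0 and (1, 0) annihilates A too.
  invertible₂⇒nonsingular : (A : Matrix 2) → Invertible A →
                            ¬ A 0F 0F * A 1F 1F ≈ A 0F 1F * A 1F 0F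
  invertible₂⇒nonsingular A (B , AB≋I , _) ad≈bc =
    0≉1 (sym (proj₁ (rows-proportional⇒≈0 1# 0# λ k → trans (*-identityˡ _)
                                                    (trans (first-row≈0 k) (sym (zeroˡ _))))))
    where
    rows-proportional⇒≈0 : ∀ x y → (∀ k → x * A 0F k ≈ y * A 1F k) → x ≈ 0# × y ≈ 0#
    rows-proportional⇒≈0 x y xA₀≈yA₁ = u≈0 0F , -‿injective (trans (u≈0 1F) (sym -0#≈0#))
      where
      u : Fin 2 → Carrier
      u 0F = x
      u 1F = - y
      u≈0 : ∀ j → u j ≈ 0#
      u≈0 = rightInvertible⇒leftKernel≈0 {A = A} {B} AB≋I u λ k → begin
        x * A 0F k + (- y * A 1F k + 0#) ≈⟨ +-cong (xA₀≈yA₁ k) (+-identityʳ _) ⟩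
        y * A 1F k + - y * A 1F k        ≈⟨ +-congˡ (-‿distribˡ-* y (A 1F k)) ⟨
        y * A 1F k + - (y * A 1F k)      ≈⟨ -‿inverseʳ _ ⟩
        0#                               ∎

    first-row≈0 : ∀ k → A 0F k ≈ 0#
    first-row≈0 0F = proj₂ (rows-proportional⇒≈0 (A 1F 0F) (A 0F 0F) λ where
      0F → *-comm _ _
      1F → trans (*-comm _ _) (sym ad≈bc))
    first-row≈0 1F = proj₂ (rows-proportional⇒≈0 (A 1F 1F) (A 0F 1F) λ where
      0F → trans (*-comm _ _) ad≈bc
      1F → *-comm _ _)

  all2x2Invertible⇒nonsingular : ∀ {s} (M : Matrix s) → All2x2Invertible M →
                                 ∀ {i j k l} → i ≢ j → k Fin.< l →
                                 ¬ M i k * M j l ≈ M i l * M j k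
  all2x2Invertible⇒nonsingular M M-2x2 {i} {j} {k} {l} i≢j k<l singular
    with Finₚ.<-cmp i j
  ... | tri< i<j _ _ = invertible₂⇒nonsingular (sub2 M i j k l) (M-2x2 i j k l i<j k<l) singular
  ... | tri≈ _ i≡j _ = i≢j i≡j
  ... | tri> _ _ j<i = invertible₂⇒nonsingular (sub2 M j i k l) (M-2x2 j i k l j<i k<l) (begin
    M j k * M i l ≈⟨ *-comm _ _ ⟩
    M i l * M j k ≈⟨ singular ⟨
    M i k * M j l ≈⟨ *-comm _ _ ⟩
    M j l * M i k ∎)

  inv : ∀ x → ¬ x ≈ 0# → Carrier
  inv x x≉0 = proj₁ (inverse x x≉0)

  *-inv : ∀ x (x≉0 : ¬ x ≈ 0#) → x * inv x x≉0 ≈ 1#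
  *-inv x x≉0 = proj₂ (inverse x x≉0)

  *-cancelˡ-≉0 : ∀ {a} → ¬ a ≈ 0# → Injective _≈_ _≈_ (a *_)
  *-cancelˡ-≉0 {a} a≉0 {x} {y} ax≈ay = begin
    x                     ≈⟨ *-identityˡ x ⟨
    1# * x                ≈⟨ *-congʳ (trans (*-comm _ a) (*-inv a a≉0)) ⟨
    inv a a≉0 * a * x     ≈⟨ *-assoc _ a x ⟩
    inv a a≉0 * (a * x)   ≈⟨ *-congˡ ax≈ay ⟩
    inv a a≉0 * (a * y)   ≈⟨ *-assoc _ a y ⟨
    inv a a≉0 * a * y     ≈⟨ *-congʳ (trans (*-comm _ a) (*-inv a a≉0)) ⟩
    1# * y                ≈⟨ *-identityˡ y ⟩
    y                     ∎

  cross-multiply : ∀ {r m r′ m′} (r≉0 : ¬ r ≈ 0#) (r′≉0 : ¬ r′ ≈ 0#) →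
                   m * inv r r≉0 ≈ m′ * inv r′ r′≉0 → r * m′ ≈ m * r′
  cross-multiply {r} {m} {r′} {m′} r≉0 r′≉0 m/r≈m′/r′ = begin
    r * m′                             ≈⟨ *-identityʳ _ ⟨
    r * m′ * 1#                        ≈⟨ *-congˡ (*-inv r′ r′≉0) ⟨
    r * m′ * (r′ * inv r′ r′≉0)        ≈⟨ regroup r m′ r′ (inv r′ r′≉0) ⟩
    m′ * inv r′ r′≉0 * (r′ * r)        ≈⟨ *-congʳ m/r≈m′/r′ ⟨
    m * inv r r≉0 * (r′ * r)           ≈⟨ regroup′ m (inv r r≉0) r′ r ⟩
    m * r′ * (r * inv r r≉0)           ≈⟨ *-congˡ (*-inv r r≉0) ⟩
    m * r′ * 1#                        ≈⟨ *-identityʳ _ ⟩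
    m * r′                             ∎
    where
    open import Algebra.Solver.CommutativeMonoid *-commutativeMonoid using (solve; _⊕_; _⊜_)
    regroup : ∀ a b c d → a * b * (c * d) ≈ b * d * (c * a)
    regroup = solve 4 (λ a b c d → (a ⊕ b) ⊕ (c ⊕ d) ⊜ (b ⊕ d) ⊕ (c ⊕ a)) ≈-refl
    regroup′ : ∀ a b c d → a * b * (c * d) ≈ a * c * (d * b)
    regroup′ = solve 4 (λ a b c d → (a ⊕ b) ⊕ (c ⊕ d) ⊜ (a ⊕ c) ⊕ (d ⊕ b)) ≈-refl

  module FiniteField {q} (order : HasOrder F q) where

    enum : Fin q → Carrier
    enum = proj₁ order

    index : Carrier → Fin q
    index x = proj₁ (proj₂ (proj₂ order) x)

    enum∘index : ∀ x → enum (index x) ≈ x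
    enum∘index x = proj₂ (proj₂ (proj₂ order) x)

    enum-injective : Injective _≡_ _≈_ enum
    enum-injective = proj₁ (proj₂ order) _ _

    index-injective : Injective _≈_ _≡_ index
    index-injective {x} {y} ix≡iy =
      trans (sym (enum∘index x)) (trans (reflexive (cong enum ix≡iy)) (enum∘index y))

    index-cong : ∀ {x y} → x ≈ y → index x ≡ index y
    index-cong {x} {y} x≈y = enum-injective (trans (enum∘index x) (trans x≈y (sym (enum∘index y))))

    _≈?_ : Decidable _≈_
    x ≈? y with index x Finₚ.≟ index y
    ... | yes ix≡iy = yes (index-injective ix≡iy)
    ... | no  ix≢iy = no (ix≢iy ∘ index-cong)

    sum-enum-invariant : ∀ {g : Carrier → Carrier} → Injective _≈_ _≈_ g →
                         sum (g ∘ enum) ≈ sum enum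
    sum-enum-invariant {g} g-inj = begin
      sum (g ∘ enum)      ≈⟨ sum-cong-≋ (λ i → enum∘index (g (enum i))) ⟨
      sum (enum ∘ shift)  ≈⟨ sum-reindex shift-inj enum ⟩
      sum enum            ∎
      where
      shift : Fin q → Fin q
      shift = index ∘ g ∘ enum

      shift-inj : Injective _≡_ _≡_ shift
      shift-inj = enum-injective ∘ g-inj ∘ index-injective

    sum-ones≈0 : sum {q} (λ _ → 1#) ≈ 0#
    sum-ones≈0 = +-identityʳ-unique (sum enum) _ (begin
      sum enum + sum {q} (λ _ → 1#)  ≈⟨ ∑-distrib-+ enum (λ _ → 1#) ⟨
      sum (λ i → enum i + 1#)       ≈⟨ sum-enum-invariant (+-cancelʳ 1# _ _) ⟩
      sum enum                      ∎)

    sum-enum≈0 : ∀ {a} → ¬ a ≈ 0# → ¬ a ≈ 1# → sum enum ≈ 0#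
    sum-enum≈0 {a} a≉0 a≉1 = *-cancelˡ-≉0 a-1≉0 (begin
      (a - 1#) * sum enum            ≈⟨ [y-z]x≈yx-zx (sum enum) a 1# ⟩
      a * sum enum - 1# * sum enum   ≈⟨ x≈y⇒x∙y⁻¹≈ε (trans a*sum≈sum (sym (*-identityˡ _))) ⟩
      0#                             ≈⟨ zeroʳ _ ⟨
      (a - 1#) * 0#                  ∎)
      where
      a-1≉0 : ¬ a - 1# ≈ 0#
      a-1≉0 = a≉1 ∘ x∙y⁻¹≈ε⇒x≈y a 1#

      a*sum≈sum : a * sum enum ≈ sum enum
      a*sum≈sum = trans (*-distribˡ-sum a enum) (sum-enum-invariant (*-cancelˡ-≉0 a≉0))

    avoids₂-given-≈ : ∀ {u v x y z} → x ≈ u → ¬ x ≈ y → ¬ x ≈ z → ¬ y ≈ z →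
                  ∃ λ a → ¬ a ≈ u × ¬ a ≈ v
    avoids₂-given-≈ {v = v} {y = y} x≈u x≉y x≉z y≉z with y ≈? v
    ... | no  y≉v = _ , x≉y ∘ trans x≈u ∘ sym , y≉v
    ... | yes y≈v = _ , x≉z ∘ trans x≈u ∘ sym , y≉z ∘ trans y≈v ∘ sym

    distinct₃⇒avoids₂ : ∀ u v {x y z} → ¬ x ≈ y → ¬ x ≈ z → ¬ y ≈ z →
                        ∃ λ a → ¬ a ≈ u × ¬ a ≈ v
    distinct₃⇒avoids₂ u v {x} x≉y x≉z y≉z with x ≈? u | x ≈? v
    ... | yes x≈u | _       = avoids₂-given-≈ x≈u x≉y x≉z y≉z
    ... | no _    | yes x≈v = map₂ swap (avoids₂-given-≈ x≈v x≉y x≉z y≉z)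
    ... | no x≉u  | no x≉v  = x , x≉u , x≉v

    recip : Carrier → Carrier
    recip x with x ≈? 0#
    ... | yes _   = 0#
    ... | no x≉0 = inv x x≉0

    -- Fin (suc q) as the projective line: zero is [0 ∶ 1], suc (index t) is [1 ∶ t].
    point : Carrier → Carrier → Fin (suc q)
    point r m with r ≈? 0#
    ... | yes _   = zero
    ... | no r≉0 = suc (index (m * inv r r≉0))

    point-injective : ∀ {r m r′ m′} → point r m ≡ point r′ m′ → r * m′ ≈ m * r′
    point-injective {r} {m} {r′} {m′} eq with r ≈? 0# | r′ ≈? 0#
    ... | yes r≈0 | yes r′≈0 =
      trans (trans (*-congʳ r≈0) (zeroˡ m′)) (sym (trans (*-congˡ r′≈0) (zeroʳ m)))
    ... | no r≉0  | no r′≉0  = cross-multiply r≉0 r′≉0 (index-injective (Finₚ.suc-injective eq))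

    slope : Fin (suc q) → Carrier
    slope zero    = 0#
    slope (suc i) = enum i

    isFinite : Fin (suc q) → Carrier
    isFinite zero    = 0#
    isFinite (suc _) = 1#

    recip-*≈slope : ∀ r m → recip r * m ≈ slope (point r m)
    recip-*≈slope r m with r ≈? 0#
    ... | yes _   = zeroˡ m
    ... | no r≉0 = trans (*-comm _ m) (sym (enum∘index _))

    recip-*-self≈isFinite : ∀ r m → recip r * r ≈ isFinite (point r m)
    recip-*-self≈isFinite r m with r ≈? 0#
    ... | yes _   = zeroˡ r
    ... | no r≉0 = trans (*-comm _ r) (*-inv r r≉0)

    module _ (M : Matrix (suc q)) (M-2x2 : All2x2Invertible M) where

      rowPoint : Fin q → Fin (suc q) → Fin (suc q)
      rowPoint c i = point (M i 0F) (M i (suc c))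

      rowPoint-injective : ∀ c → Injective _≡_ _≡_ (rowPoint c)
      rowPoint-injective c {i} {j} eq with i Finₚ.≟ j
      ... | yes i≡j = i≡j
      ... | no  i≢j = contradiction (point-injective eq) (all2x2Invertible⇒nonsingular M M-2x2 i≢j z<s)

      -- Any column other than 0 will do; index 0# merely exhibits one.
      someColumn : Fin q
      someColumn = index 0#

      recip-row : Fin (suc q) → Carrier
      recip-row i = recip (M i 0F)

      recip-row-*≈0 : ∀ {a} → ¬ a ≈ 0# → ¬ a ≈ 1# → ∀ k → sum (λ i → recip-row i * M i k) ≈ 0#
      recip-row-*≈0 _ _ 0F = begin
        sum (λ i → recip-row i * M i 0F)     ≈⟨ sum-cong-≋ (λ i → recip-*-self≈isFinite (M i 0F) (M i (suc someColumn))) ⟩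
        sum (isFinite ∘ rowPoint someColumn) ≈⟨ sum-reindex (rowPoint-injective someColumn) isFinite ⟩
        0# + sum {q} (λ _ → 1#)              ≈⟨ +-identityˡ _ ⟩
        sum {q} (λ _ → 1#)                   ≈⟨ sum-ones≈0 ⟩
        0#                                   ∎
      recip-row-*≈0 a≉0 a≉1 (suc c) = begin
        sum (λ i → recip-row i * M i (suc c))  ≈⟨ sum-cong-≋ (λ i → recip-*≈slope (M i 0F) (M i (suc c))) ⟩
        sum (slope ∘ rowPoint c)               ≈⟨ sum-reindex (rowPoint-injective c) slope ⟩
        0# + sum enum                          ≈⟨ +-identityˡ _ ⟩
        sum enum                               ≈⟨ sum-enum≈0 a≉0 a≉1 ⟩
        0#                                     ∎

      no-rightInverse : ∀ {a} → ¬ a ≈ 0# → ¬ a ≈ 1# → ∀ B → ¬ (M ⊗ B) ≋ I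
      no-rightInverse a≉0 a≉1 B MB≋I
        with j , j↦finite ← injective⇒strictlySurjective (rowPoint-injective someColumn) (suc someColumn)
        = 0≉1 (begin
          0#                                ≈⟨ zeroˡ (M j 0F) ⟨
          0# * M j 0F                       ≈⟨ *-congʳ (recip-row≈0 j) ⟨
          recip-row j * M j 0F              ≈⟨ recip-*-self≈isFinite (M j 0F) (M j (suc someColumn)) ⟩
          isFinite (rowPoint someColumn j)  ≡⟨ cong isFinite j↦finite ⟩
          1#                                ∎)
        where
        recip-row≈0 : ∀ i → recip-row i ≈ 0#
        recip-row≈0 = rightInvertible⇒leftKernel≈0 {A = M} {B} MB≋I recip-row (recip-row-*≈0 a≉0 a≉1)

  nonBinaryElement : ∀ {q} → HasOrder F (suc (suc (suc q))) → ∃ λ a → ¬ a ≈ 0# × ¬ a ≈ 1#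
  nonBinaryElement order = distinct₃⇒avoids₂ 0# 1# (distinct 0F 1F λ ()) (distinct 0F 2F λ ()) (distinct 1F 2F λ ())
    where
    open FiniteField order
    distinct : ∀ i j → i ≢ j → ¬ enum i ≈ enum j
    distinct _ _ i≢j = i≢j ∘ enum-injective

theorem10 : ∀ {c ℓ} (q : ℕ) → IsPrimePower q → 2 < q →
            (F : Field c ℓ) → HasOrder F q →
            ¬ Σ (Matrices.Matrix F (suc q)) (λ M → Matrices.IsLinear2AONT F M)
theorem10 (suc (suc (suc _))) _ (s≤s (s≤s (s≤s _))) F order (M , (B , M⊗B≋I , _) , M-2x2)
  with _ , a≉0 , a≉1 ← nonBinaryElement F order
  = FiniteField.no-rightInverse F order M M-2x2 a≉0 a≉1 B M⊗B≋I
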